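{- Let $m,n\geqslant 7$, $i_1,\dots,i_m\in[n]$ distinct and $j_1,\dots,j_m\in[n]$ distinct, and let $S_0,\dots,S_m$ be as defined in the context. Every vertex in $S_3$ can be expressed as a linear combination of vertices in $S_1\cup S_2\cup S_0$.
   Context: $P_\sigma$ is the $n\times n$ permutation matrix of $\sigma\in S_n$ ($P_\sigma(i,j)=1$ iff $\sigma(i)=j$); $P^{[2]}_\sigma$ is the $n^2\times n^2$ matrix with rows/columns indexed by pairs $(ij)$ and $P^{[2]}_\sigma(ij,kl)=P_\sigma(i,j)P_\sigma(k,l)$; these are the vertices of $\mathrm{QAP}_n=\mathrm{conv}\{P^{[2]}_\sigma:\sigma\in S_n\}$. For $0\leqslant k\leqslant m$, $S_k$ is the set of vertices $P^{[2]}_\sigma$ such that $\sigma(i_r)=j_r$ for exactly $k$ indices $r\in[m]$. -}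

module Defs where

open import Data.Nat using (ℕ)
open import Data.Fin using (Fin; _≟_)
open import Data.Fin.Permutation using (Permutation′; _⟨$⟩ʳ_)
open import Data.List using (List; length; filter; map; foldr)
open import Data.List.Base using (allFin)
open import Data.Product using (_×_; _,_)
open import Data.Bool using (if_then_else_)
open import Relation.Nullary.Decidable using (⌊_⌋)
open import Data.Rational using (ℚ; 0ℚ; 1ℚ; _*_; _+_)
import Data.List as L

P : ∀ {n} → Permutation′ n → Fin n → Fin n → ℚ
P σ i j = if ⌊ σ ⟨$⟩ʳ i ≟ j ⌋ then 1ℚ else 0ℚ

P2 : ∀ {n} → Permutation′ n → (Fin n × Fin n) → (Fin n × Fin n) → ℚ
P2 σ (i , j) (k , l) = P σ i j * P σ k l

hits : ∀ {m n} → (Fin m → Fin n) → (Fin m → Fin n) → Permutation′ n → ℕ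
hits {m} i j σ = length (filter (λ r → σ ⟨$⟩ʳ i r ≟ j r) (allFin m))

linComb : ∀ {n} → List (ℚ × Permutation′ n) → (Fin n × Fin n) → (Fin n × Fin n) → ℚ
linComb L a b = foldr _+_ 0ℚ (map (λ { (c , σ) → c * P2 σ a b }) L)

-- Let r₀, r₁, r₂ be the rows hit by τ and d a point outside {i r₀, i r₁, i r₂}.  The
-- symmetric group S₄ acts on these four points g 0 = d, g (1+w) = i r_w; extending each
-- h ∈ S₄ by the identity gives vertices τ ∘ ĥ.  An entry of P^[2]_{τ∘ĥ} depends on h only
-- through the images of at most two of the four points, so composing h with the
-- transposition of two other points shows that Σ_h sgn(h) P^[2]_{τ∘ĥ} = 0.  Hence P^[2]_τ
-- is a combination of the τ ∘ ĥ with h ≠ 1.  Such a τ ∘ ĥ only hits rows hit by τ, and it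
-- loses the hit at r_w whenever h moves 1+w, which some w must be for h ≠ 1.

module Submission where

open import Defs
open import Data.Bool using (Bool; true; false; if_then_else_)
open import Data.Empty using (⊥-elim)
open import Data.Fin using (Fin; zero; suc; _≟_)
import Data.Fin.Properties as Fin
open import Data.Fin.Permutation
  using (Permutation′; _⟨$⟩ʳ_; _⟨$⟩ˡ_; permutation; inverseˡ; inverseʳ; id; flip; lift₀; transpose; _∘ₚ_)
open import Data.List using (List; []; _∷_; map; concatMap; foldr; length; filter; lookup; allFin; drop)
open import Data.List.Properties using (filter-notAll; filter-reject)
open import Data.List.Membership.Propositional using (_∈_; lose)
open import Data.List.Membership.Propositional.Properties using (∈-allFin; ∈-lookup; ∈-filter⁺)
open import Data.List.Relation.Unary.All as All using (All; []; _∷_)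
import Data.List.Relation.Unary.All.Properties as All
open import Data.List.Relation.Unary.AllPairs using (_∷_)
open import Data.List.Relation.Unary.Unique.Propositional using (Unique)
import Data.List.Relation.Unary.Unique.Propositional.Properties as Unique
open import Data.Nat as ℕ using (ℕ; _<_; _≤_; s≤s; z≤n)
open import Data.Nat.Properties using (≤-trans)
open import Data.Product using (_×_; _,_; Σ; ∃; proj₁; proj₂)
open import Data.Rational using (ℚ; 0ℚ; 1ℚ; _*_; _+_; -_)
import Data.Rational.Properties as ℚ
open import Data.Sum using (_⊎_; inj₁; inj₂)
import Data.Vec.Functional as Vector
open import Function using (_∘_; _⇔_; mk⇔)
open import Function.Definitions using (Injective)
open import Relation.Binary.PropositionalEquality
  using (_≡_; _≢_; refl; sym; trans; cong; cong₂; subst; module ≡-Reasoning)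
open import Relation.Nullary using (¬_; Dec; yes; no; ¬?; contradiction)
open import Relation.Nullary.Decidable
  using (⌊_⌋; isYes≗does; does-⇔; dec-false; decidable-stable; toWitness; map′; _×-dec_)
open import Relation.Unary using (Pred; Decidable; _⊆_)
open import Level using (0ℓ)
open import Algebra.Properties.Group ℚ.+-0-group using (inverseˡ-unique)

⌊⌋-⇔ : ∀ {A B : Set} → A ⇔ B → (a? : Dec A) (b? : Dec B) → ⌊ a? ⌋ ≡ ⌊ b? ⌋
⌊⌋-⇔ A⇔B a? b? = trans (isYes≗does a?) (trans (does-⇔ A⇔B a? b?) (sym (isYes≗does b?)))

⌊⌋-false : ∀ {A : Set} (a? : Dec A) → ¬ A → ⌊ a? ⌋ ≡ false
⌊⌋-false a? ¬a = trans (isYes≗does a?) (dec-false a? ¬a)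

<3⇒0∨1∨2 : ∀ {k} → k < 3 → k ≡ 0 ⊎ k ≡ 1 ⊎ k ≡ 2
<3⇒0∨1∨2 (s≤s z≤n)             = inj₁ refl
<3⇒0∨1∨2 (s≤s (s≤s z≤n))       = inj₂ (inj₁ refl)
<3⇒0∨1∨2 (s≤s (s≤s (s≤s z≤n))) = inj₂ (inj₂ refl)

lookup-injective : ∀ {A : Set} {xs : List A} → Unique xs → Injective _≡_ _≡_ (lookup xs)
lookup-injective (_ ∷ _)       {zero}  {zero}  _ = refl
lookup-injective (x∉xs ∷ _)    {zero}  {suc b} e = contradiction e (All.lookup x∉xs (∈-lookup b))
lookup-injective (x∉xs ∷ _)    {suc a} {zero}  e = contradiction (sym e) (All.lookup x∉xs (∈-lookup a))
lookup-injective (_ ∷ unique) {suc a} {suc b} e = cong suc (lookup-injective unique e)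

module _ {A : Set} {P Q : Pred A 0ℓ} (P? : Decidable P) (Q? : Decidable Q) (P⇒Q : P ⊆ Q) where

  filter-absorbs : ∀ xs → filter P? (filter Q? xs) ≡ filter P? xs
  filter-absorbs []       = refl
  filter-absorbs (x ∷ xs) with Q? x
  ... | no ¬qx = trans (filter-absorbs xs) (sym (filter-reject P? (¬qx ∘ P⇒Q)))
  ... | yes _ with P? x
  ...   | yes _ = cong (x ∷_) (filter-absorbs xs)
  ...   | no _  = filter-absorbs xs

  filter-length-< : ∀ {xs y} → y ∈ xs → Q y → ¬ P y → length (filter P? xs) < length (filter Q? xs)
  filter-length-< {xs} y∈xs qy ¬py =
    subst (λ ys → length ys < length (filter Q? xs)) (filter-absorbs xs)
      (filter-notAll P? (filter Q? xs) (lose (∈-filter⁺ Q? y∈xs qy) ¬py))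

<⇒missed-point : ∀ {k n} → k < n → (f : Fin k → Fin n) → ∃ λ d → ∀ a → f a ≢ d
<⇒missed-point {k} k<n f with Fin.any? (λ d → Fin.all? (λ a → ¬? (f a ≟ d)))
... | yes missed = missed
... | no ¬missed =
  let x , y , x<y , same = Fin.pigeonhole k<n (proj₁ ∘ preimage)
  in  ⊥-elim (Fin.<-irrefl (trans (sym (proj₂ (preimage x))) (trans (cong f same) (proj₂ (preimage y)))) x<y)
  where
  preimage : ∀ d → ∃ λ a → f a ≡ d
  preimage d with Fin.¬∀⟶∃¬ k _ (λ a → ¬? (f a ≟ d)) (λ d∉f → ¬missed (d , d∉f))
  ... | a , ¬¬fa≡d = a , decidable-stable (f a ≟ d) ¬¬fa≡d

∷-Injective : ∀ {A : Set} {k} {d : A} {f : Fin k → A} →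
  Injective _≡_ _≡_ f → (∀ a → f a ≢ d) → Injective _≡_ _≡_ (d Vector.∷ f)
∷-Injective f-injective d∉f {zero}  {zero}  _ = refl
∷-Injective f-injective d∉f {zero}  {suc b} e = contradiction (sym e) (d∉f b)
∷-Injective f-injective d∉f {suc a} {zero}  e = contradiction e (d∉f a)
∷-Injective f-injective d∉f {suc a} {suc b} e = cong suc (f-injective e)

⟨$⟩ʳ-injective : ∀ {n} (π : Permutation′ n) → Injective _≡_ _≡_ (π ⟨$⟩ʳ_)
⟨$⟩ʳ-injective π e = trans (sym (inverseˡ π)) (trans (cong (π ⟨$⟩ˡ_) e) (inverseˡ π))

⌊⟨$⟩ʳ≟⌋ : ∀ {n} (π : Permutation′ n) x y → ⌊ π ⟨$⟩ʳ x ≟ y ⌋ ≡ ⌊ x ≟ π ⟨$⟩ˡ y ⌋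
⌊⟨$⟩ʳ≟⌋ π x y = ⌊⌋-⇔ (mk⇔ (λ e → trans (sym (inverseˡ π)) (cong (π ⟨$⟩ˡ_) e))
                          (λ e → trans (cong (π ⟨$⟩ʳ_) e) (inverseʳ π))) _ _

data Pattern (k : ℕ) : Set where
  constant : Bool → Pattern k
  sends    : Fin k → Fin k → Pattern k

holds : ∀ {k} → Pattern k → Permutation′ k → Bool
holds (constant b) _ = b
holds (sends a b)  h = ⌊ h ⟨$⟩ʳ a ≟ b ⌋

∀-Pattern? : ∀ {k ℓ} {P : Pred (Pattern k) ℓ} → Decidable P → Dec (∀ p → P p)
∀-Pattern? P? = map′
  (λ { (t , f , s) → λ { (constant true) → t ; (constant false) → f ; (sends a b) → s a b } })
  (λ ∀P → ∀P _ , ∀P _ , λ _ _ → ∀P _)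
  (P? (constant true) ×-dec P? (constant false) ×-dec Fin.all? λ a → Fin.all? λ b → P? (sends a b))

indicator : Bool → ℚ
indicator b = if b then 1ℚ else 0ℚ

weight : ∀ {k} → Pattern k → Pattern k → Permutation′ k → ℚ
weight p q h = indicator (holds p h) * indicator (holds q h)

signedSum : ∀ {k} → List (ℚ × Permutation′ k) → (Permutation′ k → ℚ) → ℚ
signedSum L f = foldr _+_ 0ℚ (map (λ (s , h) → s * f h) L)

signedSum-cong : ∀ {k} L {f f′ : Permutation′ k → ℚ} → (∀ h → f h ≡ f′ h) →
  signedSum L f ≡ signedSum L f′
signedSum-cong []            _    = refl
signedSum-cong ((s , h) ∷ L) f≗f′ = cong₂ _+_ (cong (s *_) (f≗f′ h)) (signedSum-cong L f≗f′)

signedSum-negate : ∀ {k n} L (φ : Permutation′ k → Permutation′ n) (f : Permutation′ n → ℚ) →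
  signedSum (map (λ (s , h) → - s , φ h) L) f ≡ - signedSum L (f ∘ φ)
signedSum-negate []            φ f = refl
signedSum-negate ((s , h) ∷ L) φ f =
  trans (cong₂ _+_ (sym (ℚ.neg-distribˡ-* s (f (φ h)))) (signedSum-negate L φ f))
        (sym (ℚ.neg-distrib-+ (s * f (φ h)) (signedSum L (f ∘ φ))))

-- A permutation of Fin (1+n) is lift₀ π followed by the transposition (0 k), in exactly one
-- way; its sign is that of π, negated unless k = 0.  The identity comes first.
signedPermutations : ∀ n → List (ℚ × Permutation′ n)
signedPermutations ℕ.zero    = (1ℚ , id) ∷ []
signedPermutations (ℕ.suc n) =
  concatMap (λ (s , π) → map (λ k → sign k * s , lift₀ π ∘ₚ transpose zero k) (allFin (ℕ.suc n)))
            (signedPermutations n)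
  where
  sign : Fin (ℕ.suc n) → ℚ
  sign zero    = 1ℚ
  sign (suc _) = - 1ℚ

MovesSuc : ∀ {c} → Permutation′ (ℕ.suc c) → Set
MovesSuc h = ∃ λ w → h ⟨$⟩ʳ suc w ≢ suc w

nontrivial₄ : List (ℚ × Permutation′ 4)
nontrivial₄ = drop 1 (signedPermutations 4)

nontrivial₄-moves : All (MovesSuc ∘ proj₂) nontrivial₄
nontrivial₄-moves =
  toWitness {a? = All.all? (λ (_ , h) → Fin.any? λ w → ¬? (h ⟨$⟩ʳ suc w ≟ suc w)) nontrivial₄} _

alternating-sum-vanishes : ∀ p q → weight p q id + signedSum nontrivial₄ (weight p q) ≡ 0ℚ
alternating-sum-vanishes = toWitness {a? = ∀-Pattern? λ p → ∀-Pattern? λ q →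
  weight p q id + signedSum nontrivial₄ (weight p q) ℚ.≟ 0ℚ} _

module Extension {k n} (g : Fin k → Fin n) (g-injective : Injective _≡_ _≡_ g) where

  data Position (x : Fin n) : Set where
    inside  : ∀ a → g a ≡ x → Position x
    outside : (∀ a → g a ≢ x) → Position x

  position : ∀ x → Position x
  position x with Fin.any? (λ a → g a ≟ x)
  ... | yes (a , ga≡x) = inside a ga≡x
  ... | no ∄a          = outside (λ a ga≡x → ∄a (a , ga≡x))

  extend : Permutation′ k → Fin n → Fin n
  extend h x with position x
  ... | inside a _ = g (h ⟨$⟩ʳ a)
  ... | outside _  = x

  extend-inside : ∀ h {a x} → g a ≡ x → extend h x ≡ g (h ⟨$⟩ʳ a)
  extend-inside h {a} {x} ga≡x with position x
  ... | inside b gb≡x = cong (λ c → g (h ⟨$⟩ʳ c)) (g-injective (trans gb≡x (sym ga≡x)))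
  ... | outside x∉g   = contradiction ga≡x (x∉g a)

  extend-outside : ∀ h {x} → (∀ a → g a ≢ x) → extend h x ≡ x
  extend-outside h {x} x∉g with position x
  ... | inside a ga≡x = contradiction ga≡x (x∉g a)
  ... | outside _     = refl

  extend-inverse : ∀ h h′ → (∀ a → h′ ⟨$⟩ʳ (h ⟨$⟩ʳ a) ≡ a) → ∀ x → extend h′ (extend h x) ≡ x
  extend-inverse h h′ h′∘h≗id x with position x
  ... | outside x∉g   = extend-outside h′ x∉g
  ... | inside a ga≡x = begin
    extend h′ (g (h ⟨$⟩ʳ a))  ≡⟨ extend-inside h′ refl ⟩
    g (h′ ⟨$⟩ʳ (h ⟨$⟩ʳ a))    ≡⟨ cong g (h′∘h≗id a) ⟩
    g a                       ≡⟨ ga≡x ⟩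
    x                         ∎
    where open ≡-Reasoning

  extend-id : ∀ x → extend id x ≡ x
  extend-id x with position x
  ... | inside _ ga≡x = ga≡x
  ... | outside _     = refl

  lift : Permutation′ k → Permutation′ n
  lift h = permutation (extend h) (extend (flip h))
    (extend-inverse (flip h) h (λ _ → inverseʳ h))
    (extend-inverse h (flip h) (λ _ → inverseˡ h))

  entryPattern : Fin n → Fin n → Pattern k
  entryPattern x u with position x | position u
  ... | inside a _ | inside b _ = sends a b
  ... | outside _  | outside _  = constant ⌊ x ≟ u ⌋
  ... | _          | _          = constant false

  extend-≟ : ∀ h x u → ⌊ extend h x ≟ u ⌋ ≡ holds (entryPattern x u) h
  extend-≟ h x u with position x | position u
  ... | inside a _    | inside b gb≡u =
    ⌊⌋-⇔ (mk⇔ (λ e → g-injective (trans e (sym gb≡u))) (λ e → trans (cong g e) gb≡u)) _ _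
  ... | inside a _    | outside u∉g   = ⌊⌋-false _ (u∉g _)
  ... | outside x∉g   | inside b gb≡u = ⌊⌋-false _ (λ x≡u → x∉g b (trans gb≡u (sym x≡u)))
  ... | outside _     | outside _     = refl

  P-lift : ∀ (τ : Permutation′ n) h x y →
    P (lift h ∘ₚ τ) x y ≡ indicator (holds (entryPattern x (τ ⟨$⟩ˡ y)) h)
  P-lift τ h x y = cong indicator (trans (⌊⟨$⟩ʳ≟⌋ τ (extend h x) y) (extend-≟ h x (τ ⟨$⟩ˡ y)))

  P-lift-id : ∀ (τ : Permutation′ n) x y → P (lift id ∘ₚ τ) x y ≡ P τ x y
  P-lift-id τ x y = cong (λ z → indicator ⌊ τ ⟨$⟩ʳ z ≟ y ⌋) (extend-id x)

  twists : Permutation′ n → List (ℚ × Permutation′ k) → List (ℚ × Permutation′ n)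
  twists τ = map (λ (s , h) → - s , lift h ∘ₚ τ)

module _ {n} (g : Fin 4 → Fin n) (g-injective : Injective _≡_ _≡_ g) (τ : Permutation′ n) where

  open Extension g g-injective

  twists-represent : ∀ a b → linComb (twists τ nontrivial₄) a b ≡ P2 τ a b
  twists-represent a@(x₁ , x₂) b@(y₁ , y₂) = begin
    linComb (twists τ nontrivial₄) a b
      ≡⟨ signedSum-negate nontrivial₄ (λ h → lift h ∘ₚ τ) (λ σ → P2 σ a b) ⟩
    - signedSum nontrivial₄ (λ h → P2 (lift h ∘ₚ τ) a b)
      ≡⟨ cong -_ (signedSum-cong nontrivial₄ P2-lift) ⟩
    - signedSum nontrivial₄ (weight p q)
      ≡˘⟨ inverseˡ-unique _ _ (alternating-sum-vanishes p q) ⟩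
    weight p q id
      ≡˘⟨ P2-lift id ⟩
    P2 (lift id ∘ₚ τ) a b
      ≡⟨ cong₂ _*_ (P-lift-id τ x₁ x₂) (P-lift-id τ y₁ y₂) ⟩
    P2 τ a b
      ∎
    where
    open ≡-Reasoning
    p q : Pattern 4
    p = entryPattern x₁ (τ ⟨$⟩ˡ x₂)
    q = entryPattern y₁ (τ ⟨$⟩ˡ y₂)
    P2-lift : ∀ h → P2 (lift h ∘ₚ τ) a b ≡ weight p q h
    P2-lift h = cong₂ _*_ (P-lift τ h x₁ x₂) (P-lift τ h y₁ y₂)

module _ {m n} (i j : Fin m → Fin n) where

  Hit : Permutation′ n → Fin m → Set
  Hit σ r = σ ⟨$⟩ʳ i r ≡ j r

  hit-enumeration : ∀ {c} σ → hits i j σ ≡ c →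
    Σ (Fin c → Fin m) λ r → Injective _≡_ _≡_ r × ∀ w → Hit σ (r w)
  hit-enumeration σ refl =
    lookup (filter hit? (allFin m)) ,
    lookup-injective (Unique.filter⁺ hit? (Unique.allFin⁺ m)) ,
    λ w → All.lookup (All.all-filter hit? (allFin m)) (∈-lookup w)
    where
    hit? : ∀ r → Dec (Hit σ r)
    hit? r = σ ⟨$⟩ʳ i r ≟ j r

module HitReduction
  {m n c} {i j : Fin m → Fin n} (i-injective : Injective _≡_ _≡_ i) (j-injective : Injective _≡_ _≡_ j)
  (τ : Permutation′ n)
  (r : Fin c → Fin m) (r-injective : Injective _≡_ _≡_ r) (r-hits : ∀ w → Hit i j τ (r w))
  (d : Fin n) (d-fresh : ∀ w → i (r w) ≢ d)
  where

  g : Fin (ℕ.suc c) → Fin n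
  g = d Vector.∷ (i ∘ r)

  g-injective : Injective _≡_ _≡_ g
  g-injective = ∷-Injective (r-injective ∘ i-injective) d-fresh

  open Extension g g-injective

  hit-unique : ∀ {a b r′} → g a ≡ i r′ → τ ⟨$⟩ʳ g b ≡ j r′ → a ≡ b
  hit-unique {zero}  {zero}  _      _       = refl
  hit-unique {zero}  {suc w} ga≡ir′ τgb≡jr′ =
    g-injective (trans ga≡ir′ (cong i (sym (j-injective (trans (sym (r-hits w)) τgb≡jr′)))))
  hit-unique {suc w}         ga≡ir′ τgb≡jr′ =
    g-injective (⟨$⟩ʳ-injective τ (trans (trans (r-hits w) (cong j (i-injective ga≡ir′))) (sym τgb≡jr′)))

  lift-hit⇒hit : ∀ h → Hit i j (lift h ∘ₚ τ) ⊆ Hit i j τ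
  -- Matching on position (i r′) also unfolds extend h (i r′) in the type of hit.
  lift-hit⇒hit h {r′} hit with position (i r′)
  ... | outside _       = hit
  ... | inside a ga≡ir′ = begin
    τ ⟨$⟩ʳ i r′            ≡˘⟨ cong (τ ⟨$⟩ʳ_) ga≡ir′ ⟩
    τ ⟨$⟩ʳ g a             ≡⟨ cong (λ b → τ ⟨$⟩ʳ g b) (hit-unique {a} {h ⟨$⟩ʳ a} ga≡ir′ hit) ⟩
    τ ⟨$⟩ʳ g (h ⟨$⟩ʳ a)    ≡⟨ hit ⟩
    j r′                   ∎
    where open ≡-Reasoning

  moved⇒¬hit : ∀ h w → h ⟨$⟩ʳ suc w ≢ suc w → ¬ Hit i j (lift h ∘ₚ τ) (r w)
  moved⇒¬hit h w moved hit =
    moved (sym (hit-unique refl (trans (cong (τ ⟨$⟩ʳ_) (sym (extend-inside h refl))) hit)))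

  lift-hits-< : ∀ h → MovesSuc h → hits i j (lift h ∘ₚ τ) < hits i j τ
  lift-hits-< h (w , moved) =
    filter-length-< (λ r′ → (lift h ∘ₚ τ) ⟨$⟩ʳ i r′ ≟ j r′) (λ r′ → τ ⟨$⟩ʳ i r′ ≟ j r′)
      (lift-hit⇒hit h) (∈-allFin (r w)) (r-hits w) (moved⇒¬hit h w moved)

  twists-hits-< : ∀ L → All (MovesSuc ∘ proj₂) L →
    All (λ (_ , σ) → hits i j σ < hits i j τ) (twists τ L)
  twists-hits-< []            []               = []
  twists-hits-< ((_ , h) ∷ L) (moved ∷ movedL) = lift-hits-< h moved ∷ twists-hits-< L movedL

lemma4 : (m n : ℕ) → 7 ≤ m → 7 ≤ n →
    (i j : Fin m → Fin n) → Injective _≡_ _≡_ i → Injective _≡_ _≡_ j →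
    (τ : Permutation′ n) → hits i j τ ≡ 3 →
    Σ (List (ℚ × Permutation′ n)) (λ L →
      All (λ cσ → hits i j (proj₂ cσ) ≡ 0 ⊎ hits i j (proj₂ cσ) ≡ 1 ⊎ hits i j (proj₂ cσ) ≡ 2) L
      × (∀ a b → linComb L a b ≡ P2 τ a b))
lemma4 m n _ 7≤n i j i-injective j-injective τ three-hits
  with r , r-injective , r-hits ← hit-enumeration i j τ three-hits
  with d , d-fresh ← <⇒missed-point (≤-trans (s≤s (s≤s (s≤s (s≤s z≤n)))) 7≤n) (i ∘ r)
  = twists τ nontrivial₄ ,
    All.map (<3⇒0∨1∨2 ∘ subst (_ <_) three-hits) (twists-hits-< nontrivial₄ nontrivial₄-moves) ,
    twists-represent g g-injective τ
  where
  open HitReduction i-injective j-injective τ r r-injective r-hits d d-fresh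
  open Extension g g-injective using (twists)
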